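{- Let $n\ge5$ be odd, $T=\langle n,3n-2,3n-1\rangle$, $\mathrm F(T)=\max(\mathbb Z\setminus T)$ and $S=T\cup\{\mathrm F(T)\}$. Let $i$ be an integer with $2\le i\le\frac{n-3}{2}$. An element $s\in\mathrm{Ap}(S,\mathrm F(T))$ belongs to $M_i$ if and only if $\mathrm{nf}(s)=(x,y,z)$ satisfies one of the following (mutually disjoint) conditions: 1) $y=i-2$, $z=1$ and $\frac{3n-5}{2}\le x\le\frac{3n-3}{2}$; 2) $y=i-1$, $z=0$ and $3(i-1)\le x\le\frac{3n-3}{2}$; 3) $y=i-1$, $z=1$ and $3(i-1)\le x\le\frac{3n-7}{2}$; 4) $i\le y\le\frac{n-3}{2}$, $z=0$ and $3(i-1)\le x\le 3i-1$; 5) $i\le y\le\frac{n-5}{2}$, $z=1$ and $3(i-1)\le x\le3i-1$.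
   Context: For $m\in S\setminus\{0\}$, $\mathrm{Ap}(S,m)=\{s\in S: s-m\notin S\}$. For $s\in\mathrm{Ap}(S,\mathrm F(T))$ (such $s$ lie in $T$), $\mathsf Z(s)=\{(x,y,z)\in\mathbb N^3: xn+y(3n-2)+z(3n-1)=s\}$, and $\mathrm{nf}(s)$ is the unique element $(x,y,z)\in\mathsf Z(s)$ with $z<2$, $y<\frac{n+1}{2}$, $x<\frac{3n-1}{2}$. For a positive integer $i$, $M_i=\{s\in\mathrm{Ap}(S,\mathrm F(T)) : \#\mathsf Z(s)=i\}$. -}

module Defs where

open import Data.Nat using (ℕ; _+_; _*_; _∸_; _≤_; _<_; _≟_)
open import Data.Product using (Σ; _×_; _,_)
open import Data.Sum using (_⊎_)
open import Data.List using (List; upTo; concatMap; map; filter; length)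
open import Relation.Nullary using (¬_)
open import Relation.Binary.PropositionalEquality using (_≡_)

Triple : Set
Triple = ℕ × ℕ × ℕ

val : ℕ → Triple → ℕ
val n (x , y , z) = x * n + y * (3 * n ∸ 2) + z * (3 * n ∸ 1)

InT : ℕ → ℕ → Set
InT n s = Σ Triple λ t → val n t ≡ s

-- F is the Frobenius number of T: F ∉ T and every larger integer lies in T
-- (negative integers are never in T, so this is max (ℤ ∖ T))
IsFrobT : ℕ → ℕ → Set
IsFrobT n F = ¬ InT n F × (∀ m → F < m → InT n m)

InS : ℕ → ℕ → ℕ → Set
InS n F s = InT n s ⊎ s ≡ F

-- s ∈ Ap(S, F) : s ∈ S and s - F ∉ S  (s - F < 0 is never in S)
InAp : ℕ → ℕ → ℕ → Set
InAp n F s = InS n F s × ¬ (F ≤ s × InS n F (s ∸ F))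

triplesUpTo : ℕ → List Triple
triplesUpTo s =
  concatMap (λ x → concatMap (λ y → map (λ z → (x , y , z)) (upTo (1 + s))) (upTo (1 + s))) (upTo (1 + s))

-- Z(s) as an explicit list of all factorizations (each coordinate of a
-- factorization is ≤ s since all generators are ≥ 1 when n ≥ 1)
Z : ℕ → ℕ → List Triple
Z n s = filter (λ t → val n t ≟ s) (triplesUpTo s)

numFact : ℕ → ℕ → ℕ
numFact n s = length (Z n s)

InM : ℕ → ℕ → ℕ → ℕ → Set
InM n F i s = InAp n F s × numFact n s ≡ i

IsNF : ℕ → ℕ → Triple → Set
IsNF n s (x , y , z) = val n (x , y , z) ≡ s × z < 2 × 2 * y < n + 1 × 2 * x < 3 * n ∸ 1

-- the five conditions of the theorem (halves cleared; n odd so all are integers)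
Cond : ℕ → ℕ → Triple → Set
Cond n i (x , y , z) =
    (y ≡ i ∸ 2 × z ≡ 1 × 3 * n ∸ 5 ≤ 2 * x × 2 * x ≤ 3 * n ∸ 3)
  ⊎ (y ≡ i ∸ 1 × z ≡ 0 × 3 * (i ∸ 1) ≤ x × 2 * x ≤ 3 * n ∸ 3)
  ⊎ (y ≡ i ∸ 1 × z ≡ 1 × 3 * (i ∸ 1) ≤ x × 2 * x ≤ 3 * n ∸ 7)
  ⊎ (i ≤ y × 2 * y ≤ n ∸ 3 × z ≡ 0 × 3 * (i ∸ 1) ≤ x × x ≤ 3 * i ∸ 1)
  ⊎ (i ≤ y × 2 * y ≤ n ∸ 5 × z ≡ 1 × 3 * (i ∸ 1) ≤ x × x ≤ 3 * i ∸ 1)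

-- Write n = 5 + 2p, so that the generators are n, 3n − 2 = 13 + 6p and 3n − 1 = 14 + 6p.
-- For a factorization (x, y, z) put weight = 2y + z and size = x + 3y + 3z; then
-- value + weight = n · size, so all factorizations of an element have the same weight
-- modulo n.  Comparing 2 · size = 2x + 3 · weight + 3z shows that the weight of another
-- factorization of the normal form (x₀, y₀, z₀) either equals its weight, and then it is
-- (x₀ − 3j, y₀ − j, z₀ + 2j), or exceeds it by exactly n, which forces z₀ = 1,
-- x₀ ≥ (3n − 5)/2 and the factorization (x₀ − (3n − 5)/2, y₀ + (n + 1)/2, 0).  Hence
-- #Z(s) = 1 + min(y₀, ⌊x₀/3⌋), plus one in the exceptional case.  The same identity gives
-- F(T) = (n − 1)(3n − 4)/2, and s − F(T) ∉ T bounds y₀ for s ∈ Ap(S, F(T)); solving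
-- #Z(s) = i under these bounds yields the five conditions.

module Submission where

open import Defs
open import Data.Nat using (ℕ; zero; suc; _+_; _*_; _∸_; _≤_; _<_; _%_; _/_; _⊓_; _≤?_; _≟_; NonZero; z≤n; s≤s)
open import Data.Nat.Properties
open import Data.Nat.DivMod using (m≡m%n+[m/n]*n; m%n<n; m/n*n≤m; /-monoˡ-≤; m*n/n≡m; m<n*o⇒m/o<n; m<n⇒m/n≡0)
open import Data.Nat.Tactic.RingSolver using (solve-∀)
open import Data.Product using (∃-syntax; _×_; _,_; proj₁; proj₂)
open import Data.Product.Function.NonDependent.Propositional using (_×-⇔_)
open import Data.Sum using (_⊎_; inj₁; inj₂)
open import Data.Sum.Function.Propositional using (_⊎-⇔_)
open import Data.List using (List; []; _∷_; _++_; map; concatMap; upTo; length; cartesianProductWith; cartesianProduct)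
open import Data.List.Properties using (map-∘; map-concatMap; concatMap-cong; length-map; length-upTo)
open import Data.List.Membership.Propositional using (_∈_)
open import Data.List.Membership.Propositional.Properties
  using (∈-upTo⁺; ∈-upTo⁻; ∈-map⁺; ∈-map⁻; ∈-cartesianProduct⁺; ∈-filter⁺; ∈-filter⁻)
open import Data.List.Membership.Propositional.Properties.WithK using (unique∧set⇒bag)
open import Data.List.Relation.Unary.All using (tabulate)
open import Data.List.Relation.Unary.AllPairs using (_∷_)
open import Data.List.Relation.Unary.Any using (here; there)
open import Data.List.Relation.Unary.Unique.Propositional using (Unique)
open import Data.List.Relation.Unary.Unique.Propositional.Properties using (upTo⁺; map⁺; cartesianProduct⁺; filter⁺)
open import Data.List.Relation.Binary.BagAndSetEquality using (∼bag⇒↭)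
open import Data.List.Relation.Binary.Permutation.Propositional.Properties using (↭-length)
open import Function using (_∘_)
open import Function.Bundles using (_⇔_; mk⇔; Equivalence)
open import Function.Construct.Composition using (_⇔-∘_)
open import Function.Construct.Identity using (⇔-id)
open import Function.Construct.Symmetry using (⇔-sym)
open import Relation.Nullary using (¬_; yes; no; contradiction)
open import Relation.Binary.Definitions using (tri<; tri≈; tri>)
open import Relation.Binary.PropositionalEquality

remainder-shift : ∀ d {v w a u} → a < d → d * v + a ≡ d * w + u →
                  ∃[ k ] v ≡ w + k × u ≡ a + d * k
remainder-shift d {v} {w} {a} {u} a<d eq with <-≤-connex v w
... | inj₁ v<w with (e , refl) ← m≤n⇒∃[o]m+o≡n v<w =
  contradiction (subst (d ≤_) (sym a≡) (m≤m+n d _)) (<⇒≱ a<d)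
  where
  a≡ : a ≡ d + (d * e + u)
  a≡ = +-cancelˡ-≡ (d * v) a _ (trans eq (expand d v e u))
    where expand : ∀ d v e u → d * (suc v + e) + u ≡ d * v + (d + (d * e + u))
          expand = solve-∀
... | inj₂ w≤v with (k , refl) ← m≤n⇒∃[o]m+o≡n w≤v =
  k , refl , +-cancelˡ-≡ (d * w) u _ (trans (sym eq) (expand d w k a))
  where expand : ∀ d w k a → d * (w + k) + a ≡ d * w + (a + d * k)
        expand = solve-∀

parity : ∀ r → ∃[ j ] (r ≡ 2 * j ⊎ r ≡ suc (2 * j))
parity zero = 0 , inj₁ refl
parity (suc r) with parity r
... | j , inj₁ refl = j , inj₂ refl
... | j , inj₂ refl = suc j , inj₁ (cong suc (sym (+-suc j (j + 0))))

2*≤1+2*⇒≤ : ∀ {a b} → 2 * a ≤ suc (2 * b) → a ≤ b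
2*≤1+2*⇒≤ {a} {b} 2a≤ = ≤-pred (*-cancelˡ-< 2 a (suc b) (subst (suc (2 * a) ≤_) (double b) (s≤s 2a≤)))
  where double : ∀ b → suc (suc (2 * b)) ≡ 2 * suc b
        double = solve-∀

2*≤⇔ : ∀ {a b c} → c ≡ 2 * b → 2 * a ≤ c ⇔ a ≤ b
2*≤⇔ refl = mk⇔ (*-cancelˡ-≤ 2) (*-monoʳ-≤ 2)

≤2*⇔ : ∀ {a b c} → c ≡ 2 * b → c ≤ 2 * a ⇔ b ≤ a
≤2*⇔ refl = mk⇔ (*-cancelˡ-≤ 2) (*-monoʳ-≤ 2)

≡⇒≡-⇔ : ∀ {a b c : ℕ} → a ≡ b → (a ≡ c) ⇔ (b ≡ c)
≡⇒≡-⇔ a≡b = mk⇔ (trans (sym a≡b)) (trans a≡b)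

m⊓n≡k⇔ : ∀ {m n k} → m ⊓ n ≡ k ⇔ (m ≡ k × k ≤ n ⊎ k < m × n ≡ k)
m⊓n≡k⇔ {m} {n} = mk⇔ to from
  where
  to : ∀ {k} → m ⊓ n ≡ k → m ≡ k × k ≤ n ⊎ k < m × n ≡ k
  to refl with m ≤? n
  ... | yes m≤n rewrite m≤n⇒m⊓n≡m m≤n = inj₁ (refl , m≤n)
  ... | no m≰n  rewrite m≥n⇒m⊓n≡n (<⇒≤ (≰⇒> m≰n)) = inj₂ (≰⇒> m≰n , refl)
  from : ∀ {k} → m ≡ k × k ≤ n ⊎ k < m × n ≡ k → m ⊓ n ≡ k
  from (inj₁ (refl , m≤n)) = m≤n⇒m⊓n≡m m≤n
  from (inj₂ (n<m , refl)) = m≥n⇒m⊓n≡n (<⇒≤ n<m)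

1+m⊓n≡2+h⇔ : ∀ {m n h} → suc (m ⊓ n) ≡ 2 + h ⇔ (m ≡ 1 + h × 1 + h ≤ n ⊎ 1 + h < m × n ≡ 1 + h)
1+m⊓n≡2+h⇔ = m⊓n≡k⇔ ⇔-∘ mk⇔ suc-injective (cong suc)

m≤n/o⇔m*o≤n : ∀ {m n} o .{{_ : NonZero o}} → m ≤ n / o ⇔ m * o ≤ n
m≤n/o⇔m*o≤n {m} {n} o = mk⇔
  (λ m≤n/o → ≤-trans (*-monoˡ-≤ o m≤n/o) (m/n*n≤m n o))
  (λ m*o≤n → subst (_≤ n / o) (m*n/n≡m m o) (/-monoˡ-≤ o m*o≤n))

m/o≡n⇔n*o≤m<[1+n]*o : ∀ {m n} o .{{_ : NonZero o}} → m / o ≡ n ⇔ (n * o ≤ m × m < suc n * o)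
m/o≡n⇔n*o≤m<[1+n]*o {m} {n} o = mk⇔ to from
  where
  to : m / o ≡ n → n * o ≤ m × m < suc n * o
  to refl = Equivalence.to (m≤n/o⇔m*o≤n o) ≤-refl ,
    subst (_< suc (m / o) * o) (sym (m≡m%n+[m/n]*n m o)) (+-monoˡ-< (m / o * o) (m%n<n m o))
  from : n * o ≤ m × m < suc n * o → m / o ≡ n
  from (lo , hi) = ≤-antisym (≤-pred (m<n*o⇒m/o<n hi)) (Equivalence.from (m≤n/o⇔m*o≤n o) lo)

3*≤⇔≤/3 : ∀ {k x} → 3 * k ≤ x ⇔ k ≤ x / 3
3*≤⇔≤/3 {k} {x} = ⇔-sym (m≤n/o⇔m*o≤n 3) ⇔-∘ mk⇔ (subst (_≤ x) (*-comm 3 k)) (subst (_≤ x) (*-comm k 3))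

3[1+h]≤x≤3[2+h]∸1⇔x/3≡1+h : ∀ h {x} → (3 * (1 + h) ≤ x × x ≤ 3 * (2 + h) ∸ 1) ⇔ x / 3 ≡ 1 + h
3[1+h]≤x≤3[2+h]∸1⇔x/3≡1+h h {x} =
  ⇔-sym (m/o≡n⇔n*o≤m<[1+n]*o 3) ⇔-∘
    (mk⇔ (subst (_≤ x) (*-comm 3 (1 + h))) (subst (_≤ x) (*-comm (1 + h) 3)) ×-⇔
     mk⇔ (λ x≤ → s≤s (subst (x ≤_) (3[2+h]∸1 h) x≤)) (λ x< → subst (x ≤_) (sym (3[2+h]∸1 h)) (≤-pred x<)))
  where 3[2+h]∸1 : ∀ h → 3 * (2 + h) ∸ 1 ≡ 2 + (1 + h) * 3
        3[2+h]∸1 h = cong (_∸ 1) (expand h)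
          where expand : ∀ h → 3 * (2 + h) ≡ 3 + (1 + h) * 3
                expand = solve-∀

odd≥5⇒≡5+2* : ∀ {n} → 5 ≤ n → n % 2 ≡ 1 → ∃[ p ] n ≡ 5 + 2 * p
odd≥5⇒≡5+2* {n} 5≤n odd = split (m≤n⇒∃[o]m+o≡n 2≤n/2)
  where
  n≡1+[n/2]*2 : n ≡ 1 + n / 2 * 2
  n≡1+[n/2]*2 = trans (m≡m%n+[m/n]*n n 2) (cong (_+ n / 2 * 2) odd)
  2≤n/2 : 2 ≤ n / 2
  2≤n/2 = Equivalence.from (m≤n/o⇔m*o≤n {2} {n} 2) (≤-trans (n≤1+n 4) 5≤n)
  split : ∃[ p ] 2 + p ≡ n / 2 → ∃[ p ] n ≡ 5 + 2 * p
  split (p , eq) = p , trans n≡1+[n/2]*2 (trans (cong (λ q → 1 + q * 2) (sym eq)) (expand p))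
    where expand : ∀ p → 1 + (2 + p) * 2 ≡ 5 + 2 * p
          expand = solve-∀

-- Counting factorizations with a duplicate-free list

concatMap-map≡cartesianProductWith : ∀ {A B C : Set} (f : A → B → C) xs ys →
  concatMap (λ x → map (f x) ys) xs ≡ cartesianProductWith f xs ys
concatMap-map≡cartesianProductWith f []       ys = refl
concatMap-map≡cartesianProductWith f (x ∷ xs) ys =
  cong (map (f x) ys ++_) (concatMap-map≡cartesianProductWith f xs ys)

unique-⇔⇒length-≡ : ∀ {A : Set} {xs ys : List A} → Unique xs → Unique ys →
  (∀ {t} → t ∈ xs ⇔ t ∈ ys) → length xs ≡ length ys
unique-⇔⇒length-≡ uxs uys xs⇔ys = ↭-length (∼bag⇒↭ (unique∧set⇒bag uxs uys xs⇔ys))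

triplesUpTo≡cartesianProduct : ∀ s → let U = upTo (1 + s) in
  triplesUpTo s ≡ cartesianProduct U (cartesianProduct U U)
triplesUpTo≡cartesianProduct s = begin
  concatMap (λ x → concatMap (λ y → map (λ z → x , y , z) U) U) U
    ≡⟨ concatMap-cong inner U ⟩
  concatMap (λ x → map (x ,_) (cartesianProduct U U)) U
    ≡⟨ concatMap-map≡cartesianProductWith _,_ U (cartesianProduct U U) ⟩
  cartesianProduct U (cartesianProduct U U) ∎
  where
  open ≡-Reasoning
  U : List ℕ
  U = upTo (1 + s)
  inner : ∀ x → concatMap (λ y → map (λ z → x , y , z) U) U ≡ map (x ,_) (cartesianProduct U U)
  inner x = begin
    concatMap (λ y → map (λ z → x , y , z) U) U   ≡⟨ concatMap-cong (λ y → map-∘ U) U ⟩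
    concatMap (λ y → map (x ,_) (map (y ,_) U)) U ≡⟨ map-concatMap (x ,_) (λ y → map (y ,_) U) U ⟨
    map (x ,_) (concatMap (λ y → map (y ,_) U) U) ≡⟨ cong (map (x ,_)) (concatMap-map≡cartesianProductWith _,_ U U) ⟩
    map (x ,_) (cartesianProduct U U)             ∎

unique-triplesUpTo : ∀ s → Unique (triplesUpTo s)
unique-triplesUpTo s = subst Unique (sym (triplesUpTo≡cartesianProduct s))
  (cartesianProduct⁺ (upTo⁺ (1 + s)) (cartesianProduct⁺ (upTo⁺ (1 + s)) (upTo⁺ (1 + s))))

∈-triplesUpTo : ∀ {s x y z} → x ≤ s → y ≤ s → z ≤ s → (x , y , z) ∈ triplesUpTo s
∈-triplesUpTo {s} {x} {y} {z} x≤s y≤s z≤s = subst ((x , y , z) ∈_) (sym (triplesUpTo≡cartesianProduct s))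
  (∈-cartesianProduct⁺ (∈-upTo⁺ (s≤s x≤s)) (∈-cartesianProduct⁺ (∈-upTo⁺ (s≤s y≤s)) (∈-upTo⁺ (s≤s z≤s))))

coordinates≤val : ∀ {n} → 1 ≤ n → ∀ x y z → x ≤ val n (x , y , z) × y ≤ val n (x , y , z) × z ≤ val n (x , y , z)
coordinates≤val {n} 1≤n x y z =
  ≤-trans (m≤m*k x 1≤n) (≤-trans (m≤m+n _ _) (m≤m+n _ _)) ,
  ≤-trans (m≤m*k y (∸-monoˡ-≤ 2 (*-monoʳ-≤ 3 1≤n))) (≤-trans (m≤n+m (y * (3 * n ∸ 2)) (x * n)) (m≤m+n _ _)) ,
  ≤-trans (m≤m*k z (≤-trans (n≤1+n 1) (∸-monoˡ-≤ 1 (*-monoʳ-≤ 3 1≤n)))) (m≤n+m _ _)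
  where
  m≤m*k : ∀ m {k} → 1 ≤ k → m ≤ m * k
  m≤m*k m {k} 1≤k = subst (_≤ m * k) (*-identityʳ m) (*-monoʳ-≤ m 1≤k)

numFact≡length : ∀ {n s} → 1 ≤ n → (L : List Triple) → Unique L →
  (∀ {t} → t ∈ L ⇔ val n t ≡ s) → numFact n s ≡ length L
numFact≡length {n} {s} 1≤n L uL L⇔ = unique-⇔⇒length-≡ uZ uL
  (mk⇔ (λ t∈Z → Equivalence.from L⇔ (proj₂ (∈-filter⁻ (λ t → val n t ≟ s) {xs = triplesUpTo s} t∈Z)))
       (λ t∈L → ∈-Z (Equivalence.to L⇔ t∈L)))
  where
  uZ : Unique (Z n s)
  uZ = filter⁺ (λ t → val n t ≟ s) {xs = triplesUpTo s} (unique-triplesUpTo s)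
  ∈-Z : ∀ {t} → val n t ≡ s → t ∈ Z n s
  ∈-Z {x , y , z} refl = let (x≤ , y≤ , z≤) = coordinates≤val 1≤n x y z in
    ∈-filter⁺ (λ t → val n t ≟ s) (∈-triplesUpTo x≤ y≤ z≤) refl

InT-+* : ∀ {n m} q → InT n m → InT n (m + q * n)
InT-+* {n} q ((x , y , z) , refl) = (x + q , y , z) , shift x y z q n (3 * n ∸ 2) (3 * n ∸ 1)
  where shift : ∀ x y z q n b c → (x + q) * n + y * b + z * c ≡ x * n + y * b + z * c + q * n
        shift = solve-∀

-- The semigroup T = ⟨n, 3n − 2, 3n − 1⟩ for n = 5 + 2p

value : ℕ → Triple → ℕ
value p (x , y , z) = x * (5 + 2 * p) + y * (13 + 6 * p) + z * (14 + 6 * p)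

val≡value : ∀ p t → val (5 + 2 * p) t ≡ value p t
val≡value p (x , y , z) = cong₂ (λ b c → x * (5 + 2 * p) + y * b + z * c) (cong (_∸ 2) (3n p)) (cong (_∸ 1) (3n p))
  where 3n : ∀ p → 3 * (5 + 2 * p) ≡ 15 + 6 * p
        3n = solve-∀

value∈T : ∀ p t → InT (5 + 2 * p) (value p t)
value∈T p t = t , val≡value p t

value≡⇒∈T : ∀ {m} p t → value p t ≡ m → InT (5 + 2 * p) m
value≡⇒∈T p t refl = value∈T p t

weight : Triple → ℕ
weight (_ , y , z) = 2 * y + z

size : Triple → ℕ
size (x , y , z) = x + 3 * y + 3 * z

value+weight≡n*size : ∀ p t → value p t + weight t ≡ (5 + 2 * p) * size t
value+weight≡n*size p (x , y , z) = identity p x y z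
  where identity : ∀ p x y z → x * (5 + 2 * p) + y * (13 + 6 * p) + z * (14 + 6 * p) + (2 * y + z)
                               ≡ (5 + 2 * p) * (x + 3 * y + 3 * z)
        identity = solve-∀

-- Since value + weight = n · size, the weight of a factorization of V is w plus a multiple of n.
factorization-moments : ∀ p x y z {V L w} → w < 5 + 2 * p → V + w ≡ (5 + 2 * p) * L →
  value p (x , y , z) ≡ V →
  ∃[ k ] 2 * y + z ≡ w + (5 + 2 * p) * k × 2 * (L + k) ≡ 2 * x + 3 * (2 * y + z) + 3 * z
factorization-moments p x y z {V} {L} {w} w<n V+w≡nL refl =
  let k , size≡ , weight≡ = remainder-shift (5 + 2 * p) {size t} {L} {w} {weight t} w<n shifted
  in k , weight≡ , trans (cong (2 *_) (sym size≡)) (double-size x y z)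
  where
  t : Triple
  t = (x , y , z)
  shifted : (5 + 2 * p) * size t + w ≡ (5 + 2 * p) * L + weight t
  shifted = begin
    (5 + 2 * p) * size t + w      ≡⟨ cong (_+ w) (value+weight≡n*size p t) ⟨
    value p t + weight t + w      ≡⟨ +-assoc (value p t) (weight t) w ⟩
    value p t + (weight t + w)    ≡⟨ cong (value p t +_) (+-comm (weight t) w) ⟩
    value p t + (w + weight t)    ≡⟨ +-assoc (value p t) w (weight t) ⟨
    value p t + w + weight t      ≡⟨ cong (_+ weight t) V+w≡nL ⟩
    (5 + 2 * p) * L + weight t    ∎
    where open ≡-Reasoning
  double-size : ∀ x y z → 2 * (x + 3 * y + 3 * z) ≡ 2 * x + 3 * (2 * y + z) + 3 * z
  double-size = solve-∀

-- F(T) = (n − 1)(3n − 4)/2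
frobenius : ℕ → ℕ
frobenius p = 22 + 23 * p + 6 * (p * p)

frobenius∉T : ∀ p → ¬ InT (5 + 2 * p) (frobenius p)
frobenius∉T p ((x , y , z) , val≡F) =
  let k , weight≡ , balance = factorization-moments p x y z {frobenius p} {5 + 3 * p} {3 + 2 * p}
                                (n≤1+n (4 + 2 * p)) (F+w≡nL p) (trans (sym (val≡value p (x , y , z))) val≡F)
  in no-shift k (trans balance (cong (λ w → 2 * x + 3 * w + 3 * z) weight≡))
  where
  F+w≡nL : ∀ p → 22 + 23 * p + 6 * (p * p) + (3 + 2 * p) ≡ (5 + 2 * p) * (5 + 3 * p)
  F+w≡nL = solve-∀
  no-shift : ∀ k → 2 * (5 + 3 * p + k) ≢ 2 * x + 3 * (3 + 2 * p + (5 + 2 * p) * k) + 3 * z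
  no-shift (suc k) eq = m≢1+m+n _ (trans eq (expand p x z k))
    where expand : ∀ p x z k → 2 * x + 3 * (3 + 2 * p + (5 + 2 * p) * suc k) + 3 * z
                              ≡ suc (2 * (5 + 3 * p + suc k) + (11 + 6 * p + 13 * k + 6 * (p * k) + 2 * x + 3 * z))
          expand = solve-∀
  no-shift zero eq = 1≢2x+3z z (+-cancelʳ-≡ (9 + 6 * p) 1 (2 * x + 3 * z) (trans (expand₁ p) (trans eq (expand₂ p x z))))
    where
    expand₁ : ∀ p → 1 + (9 + 6 * p) ≡ 2 * (5 + 3 * p + 0)
    expand₁ = solve-∀
    expand₂ : ∀ p x z → 2 * x + 3 * (3 + 2 * p + (5 + 2 * p) * 0) + 3 * z ≡ 2 * x + 3 * z + (9 + 6 * p)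
    expand₂ = solve-∀
    1≢2x+3z : ∀ z → 1 ≢ 2 * x + 3 * z
    1≢2x+3z zero    eq = even≢odd x 0 (sym (trans eq (+-identityʳ (2 * x))))
    1≢2x+3z (suc z) eq = m≢1+m+n 1 (trans eq (expand x z))
      where expand : ∀ x z → 2 * x + 3 * suc z ≡ suc (1 + (1 + 2 * x + 3 * z))
            expand = solve-∀

frobenius+2j+1 : ∀ {p} j e → j + e ≡ p → value p (2 + 3 * j , 1 + e , 0) ≡ frobenius p + suc (2 * j)
frobenius+2j+1 j e refl = identity j e
  where identity : ∀ j e → (2 + 3 * j) * (5 + 2 * (j + e)) + (1 + e) * (13 + 6 * (j + e)) + 0 * (14 + 6 * (j + e))
                           ≡ 22 + 23 * (j + e) + 6 * ((j + e) * (j + e)) + suc (2 * j)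
        identity = solve-∀

frobenius+2j+2 : ∀ {p} j e → j + e ≡ p → value p (2 + 3 * j , e , 1) ≡ frobenius p + suc (suc (2 * j))
frobenius+2j+2 j e refl = identity j e
  where identity : ∀ j e → (2 + 3 * j) * (5 + 2 * (j + e)) + e * (13 + 6 * (j + e)) + 1 * (14 + 6 * (j + e))
                           ≡ 22 + 23 * (j + e) + 6 * ((j + e) * (j + e)) + suc (suc (2 * j))
        identity = solve-∀

-- F + 1 + 2j and F + 2 + 2j for j ≤ p come from the two families above; the three
-- remaining values up to F + n have sporadic representations.
frobenius+suc∈T : ∀ p r → r < 5 + 2 * p → InT (5 + 2 * p) (frobenius p + suc r)
frobenius+suc∈T p r r<n with parity r
... | j , inj₁ refl with j ≤? p
...   | yes j≤p = let e , j+e≡p = m≤n⇒∃[o]m+o≡n j≤p in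
  value≡⇒∈T p (2 + 3 * j , 1 + e , 0) (frobenius+2j+1 j e j+e≡p)
...   | no j≰p with d , refl ← m≤n⇒∃[o]m+o≡n (≰⇒> j≰p) = large d r<n
  where
  large : ∀ d → 2 * (suc p + d) < 5 + 2 * p → InT (5 + 2 * p) (frobenius p + suc (2 * (suc p + d)))
  large 0 _ = value≡⇒∈T p (5 + 3 * p , 0 , 0) (identity p)
    where identity : ∀ p → (5 + 3 * p) * (5 + 2 * p) + 0 * (13 + 6 * p) + 0 * (14 + 6 * p)
                           ≡ 22 + 23 * p + 6 * (p * p) + suc (2 * (suc p + 0))
          identity = solve-∀
  large 1 _ = value≡⇒∈T p (0 , 1 + p , 1) (identity p)
    where identity : ∀ p → 0 * (5 + 2 * p) + (1 + p) * (13 + 6 * p) + 1 * (14 + 6 * p)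
                           ≡ 22 + 23 * p + 6 * (p * p) + suc (2 * (suc p + 1))
          identity = solve-∀
  large (suc (suc d)) r<n = contradiction (subst (_≤ 5 + 2 * p) (identity p d) r<n) (m+1+n≰m (5 + 2 * p))
    where identity : ∀ p d → suc (2 * (suc p + suc (suc d))) ≡ 5 + 2 * p + suc (1 + 2 * d)
          identity = solve-∀
frobenius+suc∈T p r r<n | j , inj₂ refl with j ≤? p
...   | yes j≤p = let e , j+e≡p = m≤n⇒∃[o]m+o≡n j≤p in
  value≡⇒∈T p (2 + 3 * j , e , 1) (frobenius+2j+2 j e j+e≡p)
...   | no j≰p with d , refl ← m≤n⇒∃[o]m+o≡n (≰⇒> j≰p) = large d r<n
  where
  large : ∀ d → suc (2 * (suc p + d)) < 5 + 2 * p → InT (5 + 2 * p) (frobenius p + suc (suc (2 * (suc p + d))))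
  large 0 _ = value≡⇒∈T p (0 , 2 + p , 0) (identity p)
    where identity : ∀ p → 0 * (5 + 2 * p) + (2 + p) * (13 + 6 * p) + 0 * (14 + 6 * p)
                           ≡ 22 + 23 * p + 6 * (p * p) + suc (suc (2 * (suc p + 0)))
          identity = solve-∀
  large (suc d) r<n = contradiction (subst (_≤ 5 + 2 * p) (identity p d) r<n) (m+1+n≰m (5 + 2 * p))
    where identity : ∀ p d → suc (suc (2 * (suc p + suc d))) ≡ 5 + 2 * p + suc (2 * d)
          identity = solve-∀

>frobenius⇒∈T : ∀ p {m} → frobenius p < m → InT (5 + 2 * p) m
>frobenius⇒∈T p F<m = let d , F+1+d≡m = m≤n⇒∃[o]m+o≡n F<m in
  subst (InT (5 + 2 * p)) (trans (F+1+r+qn≡F+1+d d) F+1+d≡m) (F+1+r+qn∈T d)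
  where
  n : ℕ
  n = 5 + 2 * p
  F+1+r+qn∈T : ∀ d → InT n (frobenius p + suc (d % n) + d / n * n)
  F+1+r+qn∈T d = InT-+* (d / n) (frobenius+suc∈T p (d % n) (m%n<n d n))
  F+1+r+qn≡F+1+d : ∀ d → frobenius p + suc (d % n) + d / n * n ≡ suc (frobenius p) + d
  F+1+r+qn≡F+1+d d = begin
    frobenius p + suc (d % n) + d / n * n     ≡⟨ +-assoc (frobenius p) (suc (d % n)) (d / n * n) ⟩
    frobenius p + suc (d % n + d / n * n)     ≡⟨ +-suc (frobenius p) (d % n + d / n * n) ⟩
    suc (frobenius p + (d % n + d / n * n))   ≡⟨ cong (λ e → suc (frobenius p + e)) (m≡m%n+[m/n]*n d n) ⟨
    suc (frobenius p + d)                     ∎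
    where open ≡-Reasoning

IsFrobT⇒≡frobenius : ∀ p {F} → IsFrobT (5 + 2 * p) F → F ≡ frobenius p
IsFrobT⇒≡frobenius p {F} (F∉T , >F⇒∈T) with <-cmp F (frobenius p)
... | tri< F<frob _ _ = contradiction (>F⇒∈T (frobenius p) F<frob) (frobenius∉T p)
... | tri≈ _ F≡frob _ = F≡frob
... | tri> _ _ frob<F = contradiction (>frobenius⇒∈T p frob<F) F∉T

-- Factorizations of a normal form

-- Bounds met by the normal form of an element of Ap(S, F(T)); the weight bound uses the
-- Apéry condition.
Reduced : ℕ → Triple → Set
Reduced p (x , y , z) = z ≤ 1 × x ≤ 6 + 3 * p × 2 * y + z < 5 + 2 * p

Exceptional : ℕ → Triple → Set
Exceptional p (x , _ , z) = z ≡ 1 × 5 + 3 * p ≤ x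

-- 3 · n + (3n − 2) = 2 · (3n − 1)
lower : Triple → ℕ → Triple
lower (x , y , z) j = x ∸ 3 * j , y ∸ j , z + 2 * j

-- (5 + 3p) · n + (3n − 1) = (3 + p) · (3n − 2)
exchange : ℕ → Triple → Triple
exchange p (x , y , _) = x ∸ (5 + 3 * p) , 3 + p + y , 0

IsLowering : Triple → Triple → Set
IsLowering (x₀ , y₀ , z₀) t = ∃[ j ] j ≤ y₀ × 3 * j ≤ x₀ × t ≡ lower (x₀ , y₀ , z₀) j

Factorization : ℕ → Triple → Triple → Set
Factorization p t₀ t = IsLowering t₀ t ⊎ (Exceptional p t₀ × t ≡ exchange p t₀)

value-lower : ∀ p {x₀ y₀} z₀ {j} → j ≤ y₀ → 3 * j ≤ x₀ → value p (lower (x₀ , y₀ , z₀) j) ≡ value p (x₀ , y₀ , z₀)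
value-lower p z₀ {j} j≤y₀ 3j≤x₀
  with b , refl ← m≤n⇒∃[o]m+o≡n j≤y₀ | a , refl ← m≤n⇒∃[o]m+o≡n 3j≤x₀
  rewrite m+n∸m≡n j b | m+n∸m≡n (3 * j) a = trade p a b z₀ j
  where trade : ∀ p a b z j → a * (5 + 2 * p) + b * (13 + 6 * p) + (z + 2 * j) * (14 + 6 * p)
                            ≡ (3 * j + a) * (5 + 2 * p) + (j + b) * (13 + 6 * p) + z * (14 + 6 * p)
        trade = solve-∀

value-exchange : ∀ p t₀ → Exceptional p t₀ → value p (exchange p t₀) ≡ value p t₀
value-exchange p (x₀ , y₀ , z₀) (refl , 5+3p≤x₀) with a , refl ← m≤n⇒∃[o]m+o≡n 5+3p≤x₀
  rewrite m+n∸m≡n (5 + 3 * p) a = trade p a y₀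
  where trade : ∀ p a y → a * (5 + 2 * p) + (3 + p + y) * (13 + 6 * p) + 0 * (14 + 6 * p)
                        ≡ (5 + 3 * p + a) * (5 + 2 * p) + y * (13 + 6 * p) + 1 * (14 + 6 * p)
        trade = solve-∀

no-shift⇒lowering : ∀ {x₀ y₀ z₀} x y z → z₀ ≤ 1 →
  2 * x₀ + 3 * z₀ ≡ 2 * x + 3 * z → 2 * y + z ≡ 2 * y₀ + z₀ → IsLowering (x₀ , y₀ , z₀) (x , y , z)
no-shift⇒lowering {x₀} {y₀} {z₀} x y z z₀≤1 balance weight≡ with y ≤? y₀
... | no y≰y₀ = contradiction (subst (_≤ 2 * y₀ + 1) (sym weight≡) (+-monoʳ-≤ (2 * y₀) z₀≤1))
                              (<⇒≱ (≤-trans (subst (_≤ 2 * y) (expand y₀) (*-monoʳ-≤ 2 (≰⇒> y≰y₀))) (m≤m+n (2 * y) z)))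
  where expand : ∀ y₀ → 2 * suc y₀ ≡ suc (2 * y₀ + 1)
        expand = solve-∀
... | yes y≤y₀ with j , refl ← m≤n⇒∃[o]m+o≡n y≤y₀ =
  j , m≤n+m j y , 3j≤x₀ , cong₂ _,_ x≡ (cong₂ _,_ (sym (m+n∸n≡m y j)) z≡)
  where
  z≡ : z ≡ z₀ + 2 * j
  z≡ = +-cancelˡ-≡ (2 * y) z _ (trans weight≡ (expand y j z₀))
    where expand : ∀ y j z₀ → 2 * (y + j) + z₀ ≡ 2 * y + (z₀ + 2 * j)
          expand = solve-∀
  x₀≡ : x₀ ≡ x + 3 * j
  x₀≡ = *-cancelˡ-≡ x₀ (x + 3 * j) 2
          (+-cancelʳ-≡ (3 * z₀) _ _ (trans balance (trans (cong (λ z → 2 * x + 3 * z) z≡) (expand x z₀ j))))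
    where expand : ∀ x z₀ j → 2 * x + 3 * (z₀ + 2 * j) ≡ 2 * (x + 3 * j) + 3 * z₀
          expand = solve-∀
  3j≤x₀ : 3 * j ≤ x₀
  3j≤x₀ = subst (3 * j ≤_) (sym x₀≡) (m≤n+m (3 * j) x)
  x≡ : x ≡ x₀ ∸ 3 * j
  x≡ = sym (trans (cong (_∸ 3 * j) x₀≡) (m+n∸n≡m x (3 * j)))

one-shift⇒exchange : ∀ p {x₀ y₀ z₀} x y z → z₀ ≤ 1 → x₀ ≤ 6 + 3 * p →
  2 * x₀ + 3 * z₀ + 2 ≡ 2 * x + 3 * z + 3 * (5 + 2 * p) → 2 * y + z ≡ 2 * y₀ + z₀ + (5 + 2 * p) →
  Exceptional p (x₀ , y₀ , z₀) × (x , y , z) ≡ exchange p (x₀ , y₀ , z₀)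
one-shift⇒exchange p {x₀} {y₀} {0} x y z _ x₀≤ balance _ =
  contradiction (subst (_≤ 14 + 6 * p) (trans balance (expand p x z)) (bound p x₀≤)) (m+1+n≰m (14 + 6 * p))
  where
  bound : ∀ p → x₀ ≤ 6 + 3 * p → 2 * x₀ + 3 * 0 + 2 ≤ 14 + 6 * p
  bound p x₀≤ = subst (2 * x₀ + 3 * 0 + 2 ≤_) (double p) (+-monoˡ-≤ 2 (+-monoˡ-≤ 0 (*-monoʳ-≤ 2 x₀≤)))
    where double : ∀ p → 2 * (6 + 3 * p) + 0 + 2 ≡ 14 + 6 * p
          double = solve-∀
  expand : ∀ p x z → 2 * x + 3 * z + 3 * (5 + 2 * p) ≡ 14 + 6 * p + suc (2 * x + 3 * z)
  expand = solve-∀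
one-shift⇒exchange p {x₀} {y₀} {1} x y (suc z) _ x₀≤ balance _ =
  contradiction (subst (_≤ 17 + 6 * p) (trans balance (expand p x z)) (bound p x₀≤)) (m+1+n≰m (17 + 6 * p))
  where
  bound : ∀ p → x₀ ≤ 6 + 3 * p → 2 * x₀ + 3 * 1 + 2 ≤ 17 + 6 * p
  bound p x₀≤ = subst (2 * x₀ + 3 * 1 + 2 ≤_) (double p) (+-monoˡ-≤ 2 (+-monoˡ-≤ 3 (*-monoʳ-≤ 2 x₀≤)))
    where double : ∀ p → 2 * (6 + 3 * p) + 3 * 1 + 2 ≡ 17 + 6 * p
          double = solve-∀
  expand : ∀ p x z → 2 * x + 3 * suc z + 3 * (5 + 2 * p) ≡ 17 + 6 * p + suc (2 * x + 3 * z)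
  expand = solve-∀
one-shift⇒exchange p {x₀} {y₀} {1} x y 0 _ _ balance weight≡ =
  (refl , subst (5 + 3 * p ≤_) (sym x₀≡) (m≤m+n (5 + 3 * p) x)) ,
  cong₂ _,_ (sym (trans (cong (_∸ (5 + 3 * p)) x₀≡) (m+n∸m≡n (5 + 3 * p) x))) (cong (_, 0) y≡)
  where
  x₀≡ : x₀ ≡ 5 + 3 * p + x
  x₀≡ = *-cancelˡ-≡ x₀ _ 2 (+-cancelʳ-≡ 5 _ _ (trans (sym (+-assoc (2 * x₀) 3 2)) (trans balance (expand p x))))
    where expand : ∀ p x → 2 * x + 3 * 0 + 3 * (5 + 2 * p) ≡ 2 * (5 + 3 * p + x) + 5
          expand = solve-∀
  y≡ : y ≡ 3 + p + y₀
  y≡ = *-cancelˡ-≡ y _ 2 (trans (sym (+-identityʳ (2 * y))) (trans weight≡ (expand p y₀)))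
    where expand : ∀ p y₀ → 2 * y₀ + 1 + (5 + 2 * p) ≡ 2 * (3 + p + y₀)
          expand = solve-∀
one-shift⇒exchange p {z₀ = suc (suc _)} _ _ _ (s≤s ()) _ _ _

factorization-of-reduced : ∀ p t₀ t → Reduced p t₀ → value p t ≡ value p t₀ → Factorization p t₀ t
factorization-of-reduced p t₀@(x₀ , y₀ , z₀) (x , y , z) (z₀≤1 , x₀≤ , weight₀<n) value≡ =
  let k , weight≡ , balance = factorization-moments p x y z {value p t₀} {size t₀} {weight t₀}
                                weight₀<n (value+weight≡n*size p t₀) value≡
  in by-shift k weight≡ (+-cancelˡ-≡ (3 * weight t₀) _ _ (trans (rearrangeˡ k) (trans balance (rearrangeʳ k weight≡))))
  where
  n : ℕ
  n = 5 + 2 * p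
  rearrangeˡ : ∀ k → 3 * weight t₀ + (2 * x₀ + 3 * z₀ + 2 * k) ≡ 2 * (size t₀ + k)
  rearrangeˡ k = expand x₀ y₀ z₀ k
    where expand : ∀ x₀ y₀ z₀ k → 3 * (2 * y₀ + z₀) + (2 * x₀ + 3 * z₀ + 2 * k) ≡ 2 * (x₀ + 3 * y₀ + 3 * z₀ + k)
          expand = solve-∀
  rearrangeʳ : ∀ k → 2 * y + z ≡ weight t₀ + n * k →
    2 * x + 3 * (2 * y + z) + 3 * z ≡ 3 * weight t₀ + (2 * x + 3 * z + 3 * (n * k))
  rearrangeʳ k weight≡ = trans (cong (λ w → 2 * x + 3 * w + 3 * z) weight≡) (expand x z (weight t₀) (n * k))
    where expand : ∀ x z w m → 2 * x + 3 * (w + m) + 3 * z ≡ 3 * w + (2 * x + 3 * z + 3 * m)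
          expand = solve-∀
  -- x₀ ≤ 6 + 3p and z₀ ≤ 1 bound the left side of the balance by 15 + 6p + 2k, so k ≤ 1.
  by-shift : ∀ k → 2 * y + z ≡ weight t₀ + n * k → 2 * x₀ + 3 * z₀ + 2 * k ≡ 2 * x + 3 * z + 3 * (n * k) →
    Factorization p t₀ (x , y , z)
  by-shift 0 weight≡ balance = inj₁ (no-shift⇒lowering x y z z₀≤1
    (trans (sym (+-identityʳ _)) (trans balance (trans (cong (λ m → 2 * x + 3 * z + 3 * m) (*-zeroʳ n)) (+-identityʳ _))))
    (trans weight≡ (trans (cong (weight t₀ +_) (*-zeroʳ n)) (+-identityʳ _))))
  by-shift 1 weight≡ balance = inj₂ (one-shift⇒exchange p x y z z₀≤1 x₀≤
    (trans balance (cong (λ m → 2 * x + 3 * z + 3 * m) (*-identityʳ n)))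
    (trans weight≡ (cong (weight t₀ +_) (*-identityʳ n))))
  by-shift (suc (suc k)) _ balance =
    contradiction (subst (_≤ 19 + 6 * p + 2 * k) (trans balance (expand p x z k)) bound) (m+1+n≰m (19 + 6 * p + 2 * k))
    where
    expand : ∀ p x z k → 2 * x + 3 * z + 3 * ((5 + 2 * p) * suc (suc k))
                         ≡ 19 + 6 * p + 2 * k + suc (10 + 6 * p + 13 * k + 6 * (p * k) + 2 * x + 3 * z)
    expand = solve-∀
    bound : 2 * x₀ + 3 * z₀ + 2 * suc (suc k) ≤ 19 + 6 * p + 2 * k
    bound = subst (2 * x₀ + 3 * z₀ + 2 * suc (suc k) ≤_) (collect p k)
              (+-monoˡ-≤ (2 * suc (suc k)) (+-mono-≤ (*-monoʳ-≤ 2 x₀≤) (*-monoʳ-≤ 3 z₀≤1)))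
      where collect : ∀ p k → 2 * (6 + 3 * p) + 3 * 1 + 2 * suc (suc k) ≡ 19 + 6 * p + 2 * k
            collect = solve-∀

val≡value⇔Factorization : ∀ p {t} t₀ → Reduced p t₀ → val (5 + 2 * p) t ≡ value p t₀ ⇔ Factorization p t₀ t
val≡value⇔Factorization p {t} t₀@(_ , _ , z₀) reduced = mk⇔
  (λ val≡ → factorization-of-reduced p t₀ t reduced (trans (sym (val≡value p t)) val≡))
  (λ { (inj₁ (j , j≤y₀ , 3j≤x₀ , refl)) → trans (val≡value p (lower t₀ j)) (value-lower p z₀ j≤y₀ 3j≤x₀)
     ; (inj₂ (exceptional , refl))       → trans (val≡value p (exchange p t₀)) (value-exchange p t₀ exceptional) })

lowerings : Triple → List Triple
lowerings t₀@(x₀ , y₀ , _) = map (lower t₀) (upTo (suc (y₀ ⊓ (x₀ / 3))))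

length-lowerings : ∀ x₀ y₀ z₀ → length (lowerings (x₀ , y₀ , z₀)) ≡ suc (y₀ ⊓ (x₀ / 3))
length-lowerings x₀ y₀ z₀ = trans (length-map (lower (x₀ , y₀ , z₀)) (upTo (suc (y₀ ⊓ (x₀ / 3))))) (length-upTo _)

unique-lowerings : ∀ t₀ → Unique (lowerings t₀)
unique-lowerings t₀@(_ , _ , z₀) = map⁺ lower-injective (upTo⁺ _)
  where lower-injective : ∀ {i j} → lower t₀ i ≡ lower t₀ j → i ≡ j
        lower-injective {i} {j} eq = *-cancelˡ-≡ i j 2 (+-cancelˡ-≡ z₀ _ _ (cong (proj₂ ∘ proj₂) eq))

∈-lowerings⇔ : ∀ {t} t₀ → t ∈ lowerings t₀ ⇔ IsLowering t₀ t
∈-lowerings⇔ t₀@(x₀ , y₀ , _) = mk⇔ to from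
  where
  bounds : ∀ {j} → j ≤ y₀ ⊓ (x₀ / 3) → j ≤ y₀ × 3 * j ≤ x₀
  bounds j≤ = m≤n⊓o⇒m≤n y₀ _ j≤ , Equivalence.from 3*≤⇔≤/3 (m≤n⊓o⇒m≤o y₀ _ j≤)
  to : ∀ {t} → t ∈ lowerings t₀ → IsLowering t₀ t
  to t∈ = let j , j∈ , t≡ = ∈-map⁻ (lower t₀) t∈
              j≤y₀ , 3j≤x₀ = bounds (≤-pred (∈-upTo⁻ j∈))
          in j , j≤y₀ , 3j≤x₀ , t≡
  from : ∀ {t} → IsLowering t₀ t → t ∈ lowerings t₀
  from (j , j≤y₀ , 3j≤x₀ , refl) = ∈-map⁺ (lower t₀)
    (∈-upTo⁺ (s≤s (⊓-glb j≤y₀ (Equivalence.to 3*≤⇔≤/3 3j≤x₀))))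

numFact-regular : ∀ p x₀ y₀ z₀ → let t₀ = (x₀ , y₀ , z₀) in Reduced p t₀ → ¬ Exceptional p t₀ →
  numFact (5 + 2 * p) (value p t₀) ≡ suc (y₀ ⊓ (x₀ / 3))
numFact-regular p x₀ y₀ z₀ reduced regular =
  trans (numFact≡length (s≤s z≤n) (lowerings t₀) (unique-lowerings t₀) (mk⇔ to from)) (length-lowerings x₀ y₀ z₀)
  where
  t₀ : Triple
  t₀ = (x₀ , y₀ , z₀)
  to : ∀ {t} → t ∈ lowerings t₀ → val (5 + 2 * p) t ≡ value p t₀
  to t∈ = Equivalence.from (val≡value⇔Factorization p t₀ reduced) (inj₁ (Equivalence.to (∈-lowerings⇔ t₀) t∈))
  ∈lowerings : ∀ {t} → Factorization p t₀ t → t ∈ lowerings t₀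
  ∈lowerings (inj₁ lowering)         = Equivalence.from (∈-lowerings⇔ t₀) lowering
  ∈lowerings (inj₂ (exceptional , _)) = contradiction exceptional regular
  from : ∀ {t} → val (5 + 2 * p) t ≡ value p t₀ → t ∈ lowerings t₀
  from val≡ = ∈lowerings (Equivalence.to (val≡value⇔Factorization p t₀ reduced) val≡)

numFact-exceptional : ∀ p x₀ y₀ z₀ → let t₀ = (x₀ , y₀ , z₀) in Reduced p t₀ → Exceptional p t₀ →
  numFact (5 + 2 * p) (value p t₀) ≡ 2 + y₀ ⊓ (x₀ / 3)
numFact-exceptional p x₀ y₀ z₀ reduced exceptional@(z₀≡1 , _) =
  trans (numFact≡length (s≤s z≤n) (exchange p t₀ ∷ lowerings t₀) unique (mk⇔ to from))
        (cong suc (length-lowerings x₀ y₀ z₀))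
  where
  t₀ : Triple
  t₀ = (x₀ , y₀ , z₀)
  exchange∉lowerings : ∀ {t} → t ∈ lowerings t₀ → exchange p t₀ ≢ t
  exchange∉lowerings t∈ refl = let j , _ , _ , exchange≡ = Equivalence.to (∈-lowerings⇔ t₀) t∈ in
    0≢1+n (trans (cong (proj₂ ∘ proj₂) exchange≡) (cong (_+ 2 * j) z₀≡1))
  unique : Unique (exchange p t₀ ∷ lowerings t₀)
  unique = tabulate exchange∉lowerings ∷ unique-lowerings t₀
  to : ∀ {t} → t ∈ exchange p t₀ ∷ lowerings t₀ → val (5 + 2 * p) t ≡ value p t₀
  to (here refl) = Equivalence.from (val≡value⇔Factorization p t₀ reduced) (inj₂ (exceptional , refl))
  to (there t∈)  = Equivalence.from (val≡value⇔Factorization p t₀ reduced) (inj₁ (Equivalence.to (∈-lowerings⇔ t₀) t∈))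
  ∈list : ∀ {t} → Factorization p t₀ t → t ∈ exchange p t₀ ∷ lowerings t₀
  ∈list (inj₁ lowering) = there (Equivalence.from (∈-lowerings⇔ t₀) lowering)
  ∈list (inj₂ (_ , refl)) = here refl
  from : ∀ {t} → val (5 + 2 * p) t ≡ value p t₀ → t ∈ exchange p t₀ ∷ lowerings t₀
  from val≡ = ∈list (Equivalence.to (val≡value⇔Factorization p t₀ reduced) val≡)

-- The Apéry set and the five conditions

InAp⇒∸F∉T : ∀ {n F s w} → InAp n F s → s ≡ F + w → ¬ InT n w
InAp⇒∸F∉T {n} {F} {w = w} (_ , ¬F≤s×s∸F∈S) refl w∈T =
  ¬F≤s×s∸F∈S (m≤m+n F w , inj₁ (subst (InT n) (sym (m+n∸m≡n F w)) w∈T))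

value≡frobenius+value₀ : ∀ p x y → value p (2 + x , 2 + p + y , 0) ≡ frobenius p + value p (x , y , 1)
value≡frobenius+value₀ p x y = identity p x y
  where identity : ∀ p x y → (2 + x) * (5 + 2 * p) + (2 + p + y) * (13 + 6 * p) + 0 * (14 + 6 * p)
                             ≡ 22 + 23 * p + 6 * (p * p) + (x * (5 + 2 * p) + y * (13 + 6 * p) + 1 * (14 + 6 * p))
        identity = solve-∀

value≡frobenius+value₁ : ∀ p x y → value p (x , 1 + p + y , 1) ≡ frobenius p + value p (1 + x , y , 0)
value≡frobenius+value₁ p x y = identity p x y
  where identity : ∀ p x y → x * (5 + 2 * p) + (1 + p + y) * (13 + 6 * p) + 1 * (14 + 6 * p)
                             ≡ 22 + 23 * p + 6 * (p * p) + ((1 + x) * (5 + 2 * p) + y * (13 + 6 * p) + 0 * (14 + 6 * p))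
        identity = solve-∀

InAp⇒bound₀ : ∀ p {x y} → InAp (5 + 2 * p) (frobenius p) (value p (x , y , 0)) → y ≤ 1 + p ⊎ x ≤ 1
InAp⇒bound₀ p {x} {y} ap with y ≤? 1 + p | x ≤? 1
... | yes y≤1+p | _       = inj₁ y≤1+p
... | no _      | yes x≤1 = inj₂ x≤1
... | no y≰1+p  | no x≰1  =
  let a , 2+a≡x = m≤n⇒∃[o]m+o≡n (≰⇒> x≰1)
      b , 2+p+b≡y = m≤n⇒∃[o]m+o≡n (≰⇒> y≰1+p)
  in contradiction (value∈T p (a , b , 1))
       (InAp⇒∸F∉T ap (trans (cong₂ (λ x y → value p (x , y , 0)) (sym 2+a≡x) (sym 2+p+b≡y)) (value≡frobenius+value₀ p a b)))

InAp⇒bound₁ : ∀ p {x y} → InAp (5 + 2 * p) (frobenius p) (value p (x , y , 1)) → y ≤ p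
InAp⇒bound₁ p {x} {y} ap with y ≤? p
... | yes y≤p = y≤p
... | no y≰p  = let b , 1+p+b≡y = m≤n⇒∃[o]m+o≡n (≰⇒> y≰p) in
  contradiction (value∈T p (1 + x , b , 0))
    (InAp⇒∸F∉T ap (trans (cong (λ y → value p (x , y , 1)) (sym 1+p+b≡y)) (value≡frobenius+value₁ p x b)))

normal-form-bounds : ∀ p {s x y z} → IsNF (5 + 2 * p) s (x , y , z) → x ≤ 6 + 3 * p × y ≤ 2 + p
normal-form-bounds p {x = x} {y} (_ , _ , 2y<n+1 , 2x<3n∸1) =
  2*≤1+2*⇒≤ (≤-pred (subst (suc (2 * x) ≤_) (3n∸1 p) 2x<3n∸1)) ,
  2*≤1+2*⇒≤ (≤-pred (subst (suc (2 * y) ≤_) (n+1 p) 2y<n+1))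
  where
  3n∸1 : ∀ p → 3 * (5 + 2 * p) ∸ 1 ≡ suc (suc (2 * (6 + 3 * p)))
  3n∸1 p = cong (_∸ 1) (expand p)
    where expand : ∀ p → 3 * (5 + 2 * p) ≡ 3 + 2 * (6 + 3 * p)
          expand = solve-∀
  n+1 : ∀ p → 5 + 2 * p + 1 ≡ suc (suc (2 * (2 + p)))
  n+1 = solve-∀

weight<n₀ : ∀ {p y} → y ≤ 2 + p → 2 * y + 0 < 5 + 2 * p
weight<n₀ {p} {y} y≤ = subst (_< 5 + 2 * p) (sym (+-identityʳ (2 * y))) (s≤s (subst (2 * y ≤_) (double p) (*-monoʳ-≤ 2 y≤)))
  where double : ∀ p → 2 * (2 + p) ≡ 4 + 2 * p
        double = solve-∀

weight<n₁ : ∀ {p y} → y ≤ p → 2 * y + 1 < 5 + 2 * p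
weight<n₁ {p} {y} y≤ = ≤-trans (≤-reflexive (shape y)) (+-mono-≤ {2} {5} (s≤s (s≤s z≤n)) (*-monoʳ-≤ 2 y≤))
  where shape : ∀ y → suc (2 * y + 1) ≡ 2 + 2 * y
        shape = solve-∀

-- The five conditions for n = 5 + 2p and i = 2 + h, with halves cleared;
-- 3(i − 1) ≤ x ≤ 3i − 1 becomes x / 3 ≡ i − 1.
Conditions : ℕ → ℕ → Triple → Set
Conditions p h (x , y , z) =
    (y ≡ h × z ≡ 1 × 5 + 3 * p ≤ x × x ≤ 6 + 3 * p)
  ⊎ (y ≡ 1 + h × z ≡ 0 × 1 + h ≤ x / 3 × x ≤ 6 + 3 * p)
  ⊎ (y ≡ 1 + h × z ≡ 1 × 1 + h ≤ x / 3 × x ≤ 4 + 3 * p)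
  ⊎ (1 + h < y × y ≤ 1 + p × z ≡ 0 × x / 3 ≡ 1 + h)
  ⊎ (1 + h < y × y ≤ p × z ≡ 1 × x / 3 ≡ 1 + h)

Cond⇔Conditions : ∀ p h x y z → Cond (5 + 2 * p) (2 + h) (x , y , z) ⇔ Conditions p h (x , y , z)
Cond⇔Conditions p h x y z =
      ⇔-id _ ×-⇔ ⇔-id _ ×-⇔ ≤2*⇔ (3n∸5 p) ×-⇔ 2*≤⇔ (3n∸3 p)
  ⊎-⇔ ⇔-id _ ×-⇔ ⇔-id _ ×-⇔ 3*≤⇔≤/3 ×-⇔ 2*≤⇔ (3n∸3 p)
  ⊎-⇔ ⇔-id _ ×-⇔ ⇔-id _ ×-⇔ 3*≤⇔≤/3 ×-⇔ 2*≤⇔ (3n∸7 p)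
  ⊎-⇔ ⇔-id _ ×-⇔ 2*≤⇔ (1+p p) ×-⇔ ⇔-id _ ×-⇔ 3[1+h]≤x≤3[2+h]∸1⇔x/3≡1+h h
  ⊎-⇔ ⇔-id _ ×-⇔ 2*≤⇔ refl ×-⇔ ⇔-id _ ×-⇔ 3[1+h]≤x≤3[2+h]∸1⇔x/3≡1+h h
  where
  3n∸5 : ∀ p → 3 * (5 + 2 * p) ∸ 5 ≡ 2 * (5 + 3 * p)
  3n∸5 p = cong (_∸ 5) (expand p)
    where expand : ∀ p → 3 * (5 + 2 * p) ≡ 5 + 2 * (5 + 3 * p)
          expand = solve-∀
  3n∸3 : ∀ p → 3 * (5 + 2 * p) ∸ 3 ≡ 2 * (6 + 3 * p)
  3n∸3 p = cong (_∸ 3) (expand p)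
    where expand : ∀ p → 3 * (5 + 2 * p) ≡ 3 + 2 * (6 + 3 * p)
          expand = solve-∀
  3n∸7 : ∀ p → 3 * (5 + 2 * p) ∸ 7 ≡ 2 * (4 + 3 * p)
  3n∸7 p = cong (_∸ 7) (expand p)
    where expand : ∀ p → 3 * (5 + 2 * p) ≡ 7 + 2 * (4 + 3 * p)
          expand = solve-∀
  1+p : ∀ p → 2 + 2 * p ≡ 2 * (1 + p)
  1+p = solve-∀

count⇔Conditions₀ : ∀ p h {x y} → y ≤ 1 + p ⊎ x ≤ 1 → x ≤ 6 + 3 * p →
  suc (y ⊓ (x / 3)) ≡ 2 + h ⇔ Conditions p h (x , y , 0)
count⇔Conditions₀ p h {x} {y} y≤1+p⊎x≤1 x≤ = mk⇔ to from ⇔-∘ 1+m⊓n≡2+h⇔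
  where
  to : y ≡ 1 + h × 1 + h ≤ x / 3 ⊎ 1 + h < y × x / 3 ≡ 1 + h → Conditions p h (x , y , 0)
  to (inj₁ (y≡ , 1+h≤x/3)) = inj₂ (inj₁ (y≡ , refl , 1+h≤x/3 , x≤))
  to (inj₂ (1+h<y , x/3≡)) = inj₂ (inj₂ (inj₂ (inj₁ (1+h<y , y≤1+p y≤1+p⊎x≤1 , refl , x/3≡))))
    where y≤1+p : y ≤ 1 + p ⊎ x ≤ 1 → y ≤ 1 + p
          y≤1+p (inj₁ y≤1+p) = y≤1+p
          y≤1+p (inj₂ x≤1)   = contradiction (trans (sym x/3≡) (m<n⇒m/n≡0 (≤-trans (s≤s x≤1) (n≤1+n 2)))) λ ()
  from : Conditions p h (x , y , 0) → y ≡ 1 + h × 1 + h ≤ x / 3 ⊎ 1 + h < y × x / 3 ≡ 1 + h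
  from (inj₁ (_ , () , _))
  from (inj₂ (inj₁ (y≡ , _ , 1+h≤x/3 , _))) = inj₁ (y≡ , 1+h≤x/3)
  from (inj₂ (inj₂ (inj₁ (_ , () , _))))
  from (inj₂ (inj₂ (inj₂ (inj₁ (1+h<y , _ , _ , x/3≡))))) = inj₂ (1+h<y , x/3≡)
  from (inj₂ (inj₂ (inj₂ (inj₂ (_ , _ , () , _)))))

count⇔Conditions₁ : ∀ p h {x y} → y ≤ p → x ≤ 4 + 3 * p →
  suc (y ⊓ (x / 3)) ≡ 2 + h ⇔ Conditions p h (x , y , 1)
count⇔Conditions₁ p h {x} {y} y≤p x≤ = mk⇔ to from ⇔-∘ 1+m⊓n≡2+h⇔
  where
  to : y ≡ 1 + h × 1 + h ≤ x / 3 ⊎ 1 + h < y × x / 3 ≡ 1 + h → Conditions p h (x , y , 1)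
  to (inj₁ (y≡ , 1+h≤x/3)) = inj₂ (inj₂ (inj₁ (y≡ , refl , 1+h≤x/3 , x≤)))
  to (inj₂ (1+h<y , x/3≡)) = inj₂ (inj₂ (inj₂ (inj₂ (1+h<y , y≤p , refl , x/3≡))))
  from : Conditions p h (x , y , 1) → y ≡ 1 + h × 1 + h ≤ x / 3 ⊎ 1 + h < y × x / 3 ≡ 1 + h
  from (inj₁ (_ , _ , 5+3p≤x , _)) = contradiction (≤-trans 5+3p≤x x≤) (n≮n (4 + 3 * p))
  from (inj₂ (inj₁ (_ , () , _)))
  from (inj₂ (inj₂ (inj₁ (y≡ , _ , 1+h≤x/3 , _)))) = inj₁ (y≡ , 1+h≤x/3)
  from (inj₂ (inj₂ (inj₂ (inj₁ (_ , _ , () , _)))))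
  from (inj₂ (inj₂ (inj₂ (inj₂ (1+h<y , _ , _ , x/3≡))))) = inj₂ (1+h<y , x/3≡)

count⇔Conditions-exceptional : ∀ p h {x y} → 1 + h ≤ p → y ≤ p → 5 + 3 * p ≤ x → x ≤ 6 + 3 * p →
  2 + y ⊓ (x / 3) ≡ 2 + h ⇔ Conditions p h (x , y , 1)
count⇔Conditions-exceptional p h {x} {y} 1+h≤p y≤p 5+3p≤x x≤ = mk⇔ to from
  where
  1+p≤x/3 : 1 + p ≤ x / 3
  1+p≤x/3 = Equivalence.to 3*≤⇔≤/3 (≤-trans (≤-reflexive (expand p)) (≤-trans (m≤n+m _ 2) 5+3p≤x))
    where expand : ∀ p → 3 * (1 + p) ≡ 3 + 3 * p
          expand = solve-∀
  y⊓x/3≡y : y ⊓ (x / 3) ≡ y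
  y⊓x/3≡y = m≤n⇒m⊓n≡m (≤-trans y≤p (≤-trans (n≤1+n p) 1+p≤x/3))
  to : 2 + y ⊓ (x / 3) ≡ 2 + h → Conditions p h (x , y , 1)
  to eq = inj₁ (trans (sym y⊓x/3≡y) (+-cancelˡ-≡ 2 _ _ eq) , refl , 5+3p≤x , x≤)
  from : Conditions p h (x , y , 1) → 2 + y ⊓ (x / 3) ≡ 2 + h
  from (inj₁ (y≡h , _)) = cong (2 +_) (trans y⊓x/3≡y y≡h)
  from (inj₂ (inj₁ (_ , () , _)))
  from (inj₂ (inj₂ (inj₁ (_ , _ , _ , x≤4+3p)))) = contradiction (≤-trans 5+3p≤x x≤4+3p) (n≮n (4 + 3 * p))
  from (inj₂ (inj₂ (inj₂ (inj₁ (_ , _ , () , _)))))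
  from (inj₂ (inj₂ (inj₂ (inj₂ (_ , _ , _ , x/3≡))))) =
    contradiction (≤-trans 1+p≤x/3 (≤-trans (≤-reflexive x/3≡) 1+h≤p)) (n≮n p)

numFact≡2+h⇔Conditions : ∀ p h → 1 + h ≤ p → ∀ {s} x y z → value p (x , y , z) ≡ s →
  InAp (5 + 2 * p) (frobenius p) s → x ≤ 6 + 3 * p → y ≤ 2 + p → z < 2 →
  numFact (5 + 2 * p) s ≡ 2 + h ⇔ Conditions p h (x , y , z)
numFact≡2+h⇔Conditions p h _ x y 0 refl ap x≤ y≤ _ =
  count⇔Conditions₀ p h (InAp⇒bound₀ p {x} {y} ap) x≤ ⇔-∘
  ≡⇒≡-⇔ (numFact-regular p x y 0 (z≤n , x≤ , weight<n₀ y≤) λ ())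
numFact≡2+h⇔Conditions p h 1+h≤p x y 1 refl ap x≤ _ _ with 5 + 3 * p ≤? x
... | yes 5+3p≤x = count⇔Conditions-exceptional p h 1+h≤p y≤p 5+3p≤x x≤ ⇔-∘
                   ≡⇒≡-⇔ (numFact-exceptional p x y 1 reduced (refl , 5+3p≤x))
  where y≤p : y ≤ p
        y≤p = InAp⇒bound₁ p {x} {y} ap
        reduced : Reduced p (x , y , 1)
        reduced = s≤s z≤n , x≤ , weight<n₁ y≤p
... | no 5+3p≰x  = count⇔Conditions₁ p h y≤p (≤-pred (≰⇒> 5+3p≰x)) ⇔-∘
                   ≡⇒≡-⇔ (numFact-regular p x y 1 reduced λ (_ , 5+3p≤x) → 5+3p≰x 5+3p≤x)
  where y≤p : y ≤ p
        y≤p = InAp⇒bound₁ p {x} {y} ap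
        reduced : Reduced p (x , y , 1)
        reduced = s≤s z≤n , x≤ , weight<n₁ y≤p
numFact≡2+h⇔Conditions _ _ _ _ _ (suc (suc _)) _ _ _ _ (s≤s (s≤s ()))

InAp⇒InM⇔ : ∀ {n F i s} → InAp n F s → InM n F i s ⇔ numFact n s ≡ i
InAp⇒InM⇔ ap = mk⇔ proj₂ (ap ,_)

mainTheorem7 : (n : ℕ) → 5 ≤ n → n % 2 ≡ 1 →
    (F : ℕ) → IsFrobT n F →
    (i : ℕ) → 2 ≤ i → 2 * i + 3 ≤ n →
    (s : ℕ) → InAp n F s →
    (t : Triple) → IsNF n s t →
    (InM n F i s ⇔ Cond n i t)
mainTheorem7 n 5≤n odd F isFrob i 2≤i 2i+3≤n s ap t@(x , y , z) nf@(val≡s , z<2 , _) =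
  with-parameters (odd≥5⇒≡5+2* 5≤n odd) (m≤n⇒∃[o]m+o≡n 2≤i)
  where
  with-parameters : ∃[ p ] n ≡ 5 + 2 * p → ∃[ h ] 2 + h ≡ i → InM n F i s ⇔ Cond n i t
  with-parameters (p , refl) (h , refl) =
    ⇔-sym (Cond⇔Conditions p h x y z) ⇔-∘
    (numFact≡2+h⇔Conditions p h 1+h≤p x y z value≡s ap′ x≤ y≤ z<2 ⇔-∘ InAp⇒InM⇔ ap)
    where
    value≡s : value p t ≡ s
    value≡s = trans (sym (val≡value p t)) val≡s
    ap′ : InAp n (frobenius p) s
    ap′ = subst (λ F → InAp n F s) (IsFrobT⇒≡frobenius p isFrob) ap
    x≤ : x ≤ 6 + 3 * p
    x≤ = proj₁ (normal-form-bounds p {s} {x} {y} {z} nf)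
    y≤ : y ≤ 2 + p
    y≤ = proj₂ (normal-form-bounds p {s} {x} {y} {z} nf)
    1+h≤p : 1 + h ≤ p
    1+h≤p = *-cancelˡ-≤ 2 (+-cancelˡ-≤ 5 _ _ (subst (_≤ 5 + 2 * p) (expand h) 2i+3≤n))
      where expand : ∀ h → 2 * (2 + h) + 3 ≡ 5 + 2 * (1 + h)
            expand = solve-∀
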